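{- Let $G$ be a maximal nontraceable graph of order $n\ge 6$, and suppose $v_1,v_2,v_3$ are vertices of degree $2$ in $G$ all having the same two neighbours $x_1$ and $x_2$. Then $G-\{v_1,v_2,v_3\}$ is a complete graph, and hence $|E(G)|=\frac12(n^2-7n+24)$.
   Context: All graphs are simple and finite. A graph is traceable if it has a hamiltonian path (a path containing all its vertices). A graph $G$ is maximal nontraceable (MNT) if $G$ is not traceable but $G+e$ is traceable for every edge $e$ of the complement $\overline{G}$. -}

module Defs where

open import Data.Nat using (ℕ; zero; suc; _<_)
open import Data.Fin using (Fin; toℕ)
open import Data.List using (List; []; _∷_; length; filter; allFin)
open import Data.List.Relation.Unary.Unique.Propositional using (Unique)
open import Data.List.Membership.Propositional using (_∈_)
open import Data.Product using (_×_; Σ; _,_)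
open import Data.Sum using (_⊎_)
open import Relation.Nullary using (¬_; Dec)
open import Relation.Binary.PropositionalEquality using (_≡_)
open import Data.Nat.Properties using (_<?_)
open import Data.Fin using (_≟_)
open import Data.Sum using (inj₁; inj₂)
open import Relation.Nullary using (yes; no)
open import Relation.Binary.PropositionalEquality using (refl) renaming (sym to ≡sym)
open import Data.Product using (proj₁; proj₂)
open import Data.List using (cartesianProduct)
open import Relation.Nullary.Decidable using (_×-dec_)

record Graph (n : ℕ) : Set₁ where
  field
    Adj   : Fin n → Fin n → Set
    adj?  : ∀ u v → Dec (Adj u v)
    sym   : ∀ {u v} → Adj u v → Adj v u
    irrefl : ∀ {u} → ¬ Adj u u
open Graph public

data IsWalk {n : ℕ} (G : Graph n) : List (Fin n) → Set where
  [] : IsWalk G []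
  [-] : ∀ v → IsWalk G (v ∷ [])
  step : ∀ {u v vs} → Adj G u v → IsWalk G (v ∷ vs) → IsWalk G (u ∷ v ∷ vs)

IsHamPath : {n : ℕ} → Graph n → List (Fin n) → Set
IsHamPath {n} G p = IsWalk G p × Unique p × (∀ v → v ∈ p)

Traceable : {n : ℕ} → Graph n → Set
Traceable G = Σ _ (λ p → IsHamPath G p)

addEdge : {n : ℕ} (G : Graph n) (u v : Fin n) → ¬ u ≡ v → Graph n
addEdge G u v u≢v = record
  { Adj = λ a b → Adj G a b ⊎ ((a ≡ u × b ≡ v) ⊎ (a ≡ v × b ≡ u))
  ; adj? = λ a b → adj? G a b ⊎-dec' (((a ≟ u) ×-dec (b ≟ v)) ⊎-dec' ((a ≟ v) ×-dec (b ≟ u)))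
  ; sym = symm
  ; irrefl = irr
  }
  where
    _⊎-dec'_ : ∀ {P Q : Set} → Dec P → Dec Q → Dec (P ⊎ Q)
    yes p ⊎-dec' _ = yes (inj₁ p)
    no _ ⊎-dec' yes q = yes (inj₂ q)
    no ¬p ⊎-dec' no ¬q = no λ { (inj₁ p) → ¬p p ; (inj₂ q) → ¬q q }
    symm : ∀ {a b} → Adj G a b ⊎ ((a ≡ u × b ≡ v) ⊎ (a ≡ v × b ≡ u)) → Adj G b a ⊎ ((b ≡ u × a ≡ v) ⊎ (b ≡ v × a ≡ u))
    symm (inj₁ e) = inj₁ (Graph.sym G e)
    symm (inj₂ (inj₁ (p , q))) = inj₂ (inj₂ (q , p))
    symm (inj₂ (inj₂ (p , q))) = inj₂ (inj₁ (q , p))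
    irr : ∀ {a} → ¬ (Adj G a a ⊎ ((a ≡ u × a ≡ v) ⊎ (a ≡ v × a ≡ u)))
    irr (inj₁ e) = irrefl G e
    irr (inj₂ (inj₁ (refl , q))) = u≢v q
    irr (inj₂ (inj₂ (refl , q))) = u≢v (≡sym q)

MaximalNontraceable : {n : ℕ} → Graph n → Set
MaximalNontraceable {n} G =
  ¬ Traceable G ×
  (∀ (u v : Fin n) (u≢v : ¬ u ≡ v) → ¬ Adj G u v → Traceable (addEdge G u v u≢v))

degree : {n : ℕ} → Graph n → Fin n → ℕ
degree {n} G v = length (filter (adj? G v) (allFin n))

edgeCount : {n : ℕ} → Graph n → ℕ
edgeCount {n} G =
  length (filter (λ (p : Fin n × Fin n) → (toℕ (proj₁' p) <? toℕ (proj₂' p)) ×-dec adj? G (proj₁' p) (proj₂' p))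
                 (allPairs n))
  where
    proj₁' = proj₁
    proj₂' = proj₂
    allPairs : ∀ n → List (Fin n × Fin n)
    allPairs n = cartesianProduct (allFin n) (allFin n)

-- Each vᵢ has degree 2, so its neighbourhood is exactly X = {x₁, x₂}.  Deleting the occurrences of
-- X from a walk leaves at most #X + 1 segments; every occurrence of a vertex of V = {v₁, v₂, v₃} is a
-- whole segment, and a vertex outside X ∪ V (one exists as n ≥ 6) lies in yet another one.  So a
-- walk through such a vertex meets V at most as often as X, whereas a hamiltonian path meets V three
-- times and X twice.  Hence G + uw is not traceable for distinct u, w ∉ V, and by maximality uw is an
-- edge.  The degrees are then 2 on V, n - 1 on X and n - 4 elsewhere, and the handshake lemma gives
-- the number of edges.  Nothing changes for any k vertices with a common neighbourhood of ℓ < k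
-- vertices.
module Submission where

open import Defs hiding (sym)

open import Level using (0ℓ)
open import Function using (id; _∘_; case_of_)
open import Data.Nat using (ℕ; zero; suc; _+_; _*_; _≤_; _<_; z≤n; s≤s)
open import Data.Nat.Properties
  using (≤-refl; ≤-trans; ≤-reflexive; ≤-antisym; +-mono-≤; m≤m+n; m≤n⇒m≤1+n;
         +-identityʳ; +-suc; <⇒≱; <-cmp; <-asym; 1+n≰n; _<?_; +-*-semiring; module ≤-Reasoning)
open import Data.Fin using (Fin; zero; suc; toℕ; _≟_)
open import Data.Fin.Properties using (toℕ-injective; ¬∀⟶∃¬)
open import Data.List
  using (List; []; _∷_; _++_; length; filter; map; tabulate; allFin; cartesianProduct)
open import Data.List.Properties
  using (length-++; length-filter; length-tabulate; filter-++; filter-accept; filter-reject)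
open import Data.List.Membership.Propositional using (_∈_; _∉_)
open import Data.List.Membership.Propositional.Properties
  using (∈-allFin; ∈-filter⁺; ∈-++⁺ˡ; ∈-++⁺ʳ)
open import Data.List.Relation.Unary.Any using (here; there; toSum; fromSum)
open import Data.List.Relation.Unary.All as All using (All; []; _∷_)
open import Data.List.Relation.Unary.All.Properties using (¬Any⇒All¬)
open import Data.List.Relation.Unary.AllPairs using ([]; _∷_)
open import Data.List.Relation.Unary.Unique.Propositional using (Unique)
open import Data.List.Relation.Unary.Unique.Propositional.Properties using (allFin⁺)
open import Data.Sum using (inj₁; inj₂)
open import Data.Product using (_×_; _,_; proj₁; proj₂; ∃-syntax)
open import Relation.Nullary using (Dec; yes; no; ¬_; contradiction)
open import Relation.Nullary.Decidable using (_×-dec_; decidable-stable)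
open import Relation.Unary using (Pred; Decidable; _⊆_; ∁)
open import Relation.Unary.Properties using (_∪?_; _∩?_; ∁?)
open import Relation.Binary.Definitions using (DecidableEquality; tri<; tri≈; tri>)
open import Relation.Binary.PropositionalEquality
  using (_≡_; refl; sym; trans; cong; cong₂; subst; module ≡-Reasoning)
open import Data.Nat.Tactic.RingSolver using (solve-∀)
open import Algebra.Properties.Semiring.Sum +-*-semiring
  using (sum-syntax; sum-cong-≗; ∑-distrib-+; ∑-comm; *-distribˡ-sum)

𝟙 : {P : Set} → Dec P → ℕ
𝟙 (yes _) = 1
𝟙 (no _)  = 0

𝟙-yes : {P : Set} (P? : Dec P) → P → 𝟙 P? ≡ 1
𝟙-yes (yes _) _ = refl
𝟙-yes (no ¬p) p = contradiction p ¬p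

𝟙-no : {P : Set} (P? : Dec P) → ¬ P → 𝟙 P? ≡ 0
𝟙-no (yes p) ¬p = contradiction p ¬p
𝟙-no (no _)  _  = refl

count : {A : Set} {P : Pred A 0ℓ} → Decidable P → List A → ℕ
count P? xs = length (filter P? xs)

module _ {A : Set} {P : Pred A 0ℓ} (P? : Decidable P) where

  count-∷ : ∀ x xs → count P? (x ∷ xs) ≡ 𝟙 (P? x) + count P? xs
  count-∷ x xs with P? x
  ... | yes _ = refl
  ... | no _  = refl

  count-accept : ∀ {x} xs → P x → count P? (x ∷ xs) ≡ suc (count P? xs)
  count-accept xs Px = cong length (filter-accept P? Px)

  count-reject : ∀ {x} xs → ¬ P x → count P? (x ∷ xs) ≡ count P? xs
  count-reject xs ¬Px = cong length (filter-reject P? ¬Px)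

  count-++ : ∀ xs ys → count P? (xs ++ ys) ≡ count P? xs + count P? ys
  count-++ xs ys = trans (cong length (filter-++ P? xs ys)) (length-++ (filter P? xs))

  count-map : {B : Set} (f : B → A) (ys : List B) →
              count P? (map f ys) ≡ count (λ y → P? (f y)) ys
  count-map f []       = refl
  count-map f (y ∷ ys) with P? (f y)
  ... | yes _ = cong suc (count-map f ys)
  ... | no _  = count-map f ys

  count-tabulate : ∀ {n} (f : Fin n → A) → count P? (tabulate f) ≡ ∑[ i < n ] 𝟙 (P? (f i))
  count-tabulate {zero}  f = refl
  count-tabulate {suc n} f =
    trans (count-∷ (f zero) _) (cong (𝟙 (P? (f zero)) +_) (count-tabulate (f ∘ suc)))

  count-∁ : ∀ xs → count P? xs + count (∁? P?) xs ≡ length xs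
  count-∁ []       = refl
  count-∁ (x ∷ xs) with P? x
  ... | yes _ = cong suc (count-∁ xs)
  ... | no _  = trans (+-suc (count P? xs) _) (cong suc (count-∁ xs))

  count-none : ∀ {xs} → All (∁ P) xs → count P? xs ≡ 0
  count-none {x ∷ xs} (¬Px ∷ ¬Pxs) = trans (count-reject xs ¬Px) (count-none ¬Pxs)
  count-none {[]}     []           = refl

count-mono : {A : Set} {P Q : Pred A 0ℓ} (P? : Decidable P) (Q? : Decidable Q) →
             P ⊆ Q → ∀ xs → count P? xs ≤ count Q? xs
count-mono P? Q? P⊆Q []       = z≤n
count-mono P? Q? P⊆Q (x ∷ xs) with P? x | Q? x
... | yes _  | yes _  = s≤s (count-mono P? Q? P⊆Q xs)
... | yes Px | no ¬Qx = contradiction (P⊆Q Px) ¬Qx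
... | no _   | yes _  = m≤n⇒m≤1+n (count-mono P? Q? P⊆Q xs)
... | no _   | no _   = count-mono P? Q? P⊆Q xs

count-cong : {A : Set} {P Q : Pred A 0ℓ} (P? : Decidable P) (Q? : Decidable Q) →
             P ⊆ Q → Q ⊆ P → ∀ xs → count P? xs ≡ count Q? xs
count-cong P? Q? P⊆Q Q⊆P xs = ≤-antisym (count-mono P? Q? P⊆Q xs) (count-mono Q? P? Q⊆P xs)

module _ {A : Set} {P Q : Pred A 0ℓ} (P? : Decidable P) (Q? : Decidable Q) where

  count-∪ : ∀ xs → count (P? ∪? Q?) xs + count (P? ∩? Q?) xs ≡ count P? xs + count Q? xs
  count-∪ []       = refl
  count-∪ (x ∷ xs) with P? x | Q? x
  ... | yes _ | yes _ = cong suc (begin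
    count (P? ∪? Q?) xs + suc (count (P? ∩? Q?) xs) ≡⟨ +-suc _ _ ⟩
    suc (count (P? ∪? Q?) xs + count (P? ∩? Q?) xs) ≡⟨ cong suc (count-∪ xs) ⟩
    suc (count P? xs + count Q? xs)                 ≡⟨ +-suc _ _ ⟨
    count P? xs + suc (count Q? xs)                 ∎)
    where open ≡-Reasoning
  ... | yes _ | no _  = cong suc (count-∪ xs)
  ... | no _  | yes _ = trans (cong suc (count-∪ xs)) (sym (+-suc _ _))
  ... | no _  | no _  = count-∪ xs

  count-∪≤ : ∀ xs → count (P? ∪? Q?) xs ≤ count P? xs + count Q? xs
  count-∪≤ xs = ≤-trans (m≤m+n _ _) (≤-reflexive (count-∪ xs))

  count-∪-disjoint : (∀ {x} → ¬ (P x × Q x)) →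
                     ∀ xs → count (P? ∪? Q?) xs ≡ count P? xs + count Q? xs
  count-∪-disjoint P∩Q≡∅ xs = begin
    count (P? ∪? Q?) xs
      ≡⟨ +-identityʳ _ ⟨
    count (P? ∪? Q?) xs + 0
      ≡⟨ cong (count (P? ∪? Q?) xs +_) (count-none (P? ∩? Q?) ∩-none) ⟨
    count (P? ∪? Q?) xs + count (P? ∩? Q?) xs
      ≡⟨ count-∪ xs ⟩
    count P? xs + count Q? xs ∎
    where
    open ≡-Reasoning
    ∩-none : All (∁ (λ x → P x × Q x)) xs
    ∩-none = All.tabulate (λ _ → P∩Q≡∅)

module _ {A : Set} (_≟_ : DecidableEquality A) where

  open import Data.List.Membership.DecPropositional _≟_ using (_∈?_)

  count-≟≤1 : ∀ {a xs} → Unique xs → count (_≟ a) xs ≤ 1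
  count-≟≤1 {a} {[]}     []           = z≤n
  count-≟≤1 {a} {x ∷ xs} (x∉xs ∷ xs!) with x ≟ a
  ... | yes refl = s≤s (≤-reflexive (count-none (_≟ a) (All.map (_∘ sym) x∉xs)))
  ... | no _     = count-≟≤1 xs!

  1≤count-≟ : ∀ {a xs} → a ∈ xs → 1 ≤ count (_≟ a) xs
  1≤count-≟ {a} {x ∷ xs} a∈ with x ≟ a
  1≤count-≟ _            | yes _  = s≤s z≤n
  1≤count-≟ (here a≡x)   | no x≢a = contradiction (sym a≡x) x≢a
  1≤count-≟ (there a∈xs) | no _   = 1≤count-≟ a∈xs

  count-∈?-∷ : ∀ v vs xs → count (_∈? v ∷ vs) xs ≡ count ((_≟ v) ∪? (_∈? vs)) xs
  count-∈?-∷ v vs = count-cong (_∈? v ∷ vs) ((_≟ v) ∪? (_∈? vs)) toSum fromSum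

  count-∈?≤length : ∀ {xs} → Unique xs → ∀ vs → count (_∈? vs) xs ≤ length vs
  count-∈?≤length {xs} xs! []       = ≤-reflexive (count-none (_∈? []) {xs} (All.tabulate λ _ ()))
  count-∈?≤length {xs} xs! (v ∷ vs) = begin
    count (_∈? v ∷ vs) xs                ≡⟨ count-∈?-∷ v vs xs ⟩
    count ((_≟ v) ∪? (_∈? vs)) xs        ≤⟨ count-∪≤ (_≟ v) (_∈? vs) xs ⟩
    count (_≟ v) xs + count (_∈? vs) xs  ≤⟨ +-mono-≤ (count-≟≤1 xs!) (count-∈?≤length xs! vs) ⟩
    suc (length vs)                      ∎
    where open ≤-Reasoning

  length≤count-∈? : ∀ {vs xs} → Unique vs → (∀ {v} → v ∈ vs → v ∈ xs) →
                    length vs ≤ count (_∈? vs) xs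
  length≤count-∈? {[]}          []           _     = z≤n
  length≤count-∈? {v ∷ vs} {xs} (v∉vs ∷ vs!) vs⊆xs = begin
    suc (length vs)                      ≤⟨ +-mono-≤ (1≤count-≟ (vs⊆xs (here refl)))
                                                     (length≤count-∈? vs! (vs⊆xs ∘ there)) ⟩
    count (_≟ v) xs + count (_∈? vs) xs  ≡⟨ count-∪-disjoint (_≟ v) (_∈? vs) disjoint xs ⟨
    count ((_≟ v) ∪? (_∈? vs)) xs        ≡⟨ count-∈?-∷ v vs xs ⟨
    count (_∈? v ∷ vs) xs                ∎
    where
    open ≤-Reasoning
    disjoint : ∀ {x} → ¬ (x ≡ v × x ∈ vs)
    disjoint (refl , x∈vs) = All.lookup v∉vs x∈vs refl

  Unique⇒length≤ : ∀ {us xs} → Unique us → (∀ {u} → u ∈ us → u ∈ xs) → length us ≤ length xs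
  Unique⇒length≤ {us} {xs} us! us⊆xs =
    ≤-trans (length≤count-∈? us! us⊆xs) (length-filter (_∈? us) xs)

∑-const : ∀ n c → ∑[ i < n ] c ≡ n * c
∑-const zero    c = refl
∑-const (suc n) c = cong (c +_) (∑-const n c)

∑-distrib₃ : ∀ {n} (f g h : Fin n → ℕ) →
             ∑[ i < n ] (f i + g i + h i) ≡ ∑[ i < n ] f i + ∑[ i < n ] g i + ∑[ i < n ] h i
∑-distrib₃ f g h = trans (∑-distrib-+ (λ i → f i + g i) h) (cong (_+ _) (∑-distrib-+ f g))

count-cartesianProduct : {A B : Set} {P : Pred (A × B) 0ℓ} (P? : Decidable P)
                         {m : ℕ} (f : Fin m → A) (ys : List B) →
                         count P? (cartesianProduct (tabulate f) ys)
                           ≡ ∑[ i < m ] count (λ y → P? (f i , y)) ys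
count-cartesianProduct P? {zero}  f ys = refl
count-cartesianProduct P? {suc m} f ys = begin
  count P? (map (f zero ,_) ys ++ cartesianProduct (tabulate (f ∘ suc)) ys)
    ≡⟨ count-++ P? (map (f zero ,_) ys) _ ⟩
  count P? (map (f zero ,_) ys) + count P? (cartesianProduct (tabulate (f ∘ suc)) ys)
    ≡⟨ cong₂ _+_ (count-map P? (f zero ,_) ys) (count-cartesianProduct P? (f ∘ suc) ys) ⟩
  count (λ y → P? (f zero , y)) ys + ∑[ i < m ] count (λ y → P? (f (suc i) , y)) ys
    ∎
  where open ≡-Reasoning

module _ {n : ℕ} where

  open import Data.List.Membership.DecPropositional (_≟_ {n}) using (_∈?_)

  count-∈?-allFin : ∀ {vs} → Unique vs → count (_∈? vs) (allFin n) ≡ length vs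
  count-∈?-allFin {vs} vs! =
    ≤-antisym (count-∈?≤length _≟_ (allFin⁺ n) vs)
              (length≤count-∈? _≟_ vs! (λ {v} _ → ∈-allFin v))

  ∑-*𝟙-∈? : ∀ c {vs} → Unique vs → ∑[ u < n ] (c * 𝟙 (u ∈? vs)) ≡ c * length vs
  ∑-*𝟙-∈? c {vs} vs! = begin
    ∑[ u < n ] (c * 𝟙 (u ∈? vs))  ≡⟨ *-distribˡ-sum c (λ u → 𝟙 (u ∈? vs)) ⟨
    c * ∑[ u < n ] 𝟙 (u ∈? vs)    ≡⟨ cong (c *_) (count-tabulate (_∈? vs) id) ⟨
    c * count (_∈? vs) (allFin n) ≡⟨ cong (c *_) (count-∈?-allFin vs!) ⟩
    c * length vs                 ∎
    where open ≡-Reasoning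

  ∃∉-of-length< : ∀ (xs : List (Fin n)) → length xs < n → ∃[ y ] y ∉ xs
  ∃∉-of-length< xs |xs|<n = ¬∀⟶∃¬ n (_∈ xs) (_∈? xs) λ all∈xs →
    <⇒≱ |xs|<n (subst (_≤ length xs) (length-tabulate id)
                      (Unique⇒length≤ _≟_ (allFin⁺ n) (λ {u} _ → all∈xs u)))

  module _ (G : Graph n) where

    length≤degree : ∀ {u vs} → Unique vs → All (Adj G u) vs → length vs ≤ degree G u
    length≤degree {u} vs! u~vs =
      Unique⇒length≤ _≟_ vs! (λ {v} v∈vs → ∈-filter⁺ (adj? G u) (∈-allFin v) (All.lookup u~vs v∈vs))

    ∈-of-degree≡length : ∀ {u vs w} → degree G u ≡ length vs → Unique vs → All (Adj G u) vs →
                         Adj G u w → w ∈ vs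
    ∈-of-degree≡length {u} {vs} {w} deg vs! u~vs u~w with w ∈? vs
    ... | yes w∈vs = w∈vs
    ... | no  w∉vs = contradiction (subst (suc (length vs) ≤_) deg |w∷vs|≤degree) 1+n≰n
      where
      |w∷vs|≤degree : length (w ∷ vs) ≤ degree G u
      |w∷vs|≤degree = length≤degree (¬Any⇒All¬ vs w∉vs ∷ vs!) (u~w ∷ u~vs)

    degree+length≡n : ∀ {u vs} → Unique vs →
                      (∀ {w} → w ∉ vs → Adj G u w) → (∀ {w} → Adj G u w → w ∉ vs) →
                      degree G u + length vs ≡ n
    degree+length≡n {u} {vs} vs! ∉⇒adj adj⇒∉ = begin
      degree G u + length vs
        ≡⟨ cong (degree G u +_) (count-∈?-allFin vs!) ⟨
      degree G u + count (_∈? vs) (allFin n)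
        ≡⟨ cong (degree G u +_) (count-cong (_∈? vs) (∁? (adj? G u)) ∈⇒¬adj ¬adj⇒∈ (allFin n)) ⟩
      count (adj? G u) (allFin n) + count (∁? (adj? G u)) (allFin n)
        ≡⟨ count-∁ (adj? G u) (allFin n) ⟩
      length (allFin n)
        ≡⟨ length-tabulate id ⟩
      n ∎
      where
      open ≡-Reasoning
      ∈⇒¬adj : ∀ {w} → w ∈ vs → ¬ Adj G u w
      ∈⇒¬adj w∈vs u~w = adj⇒∉ u~w w∈vs
      ¬adj⇒∈ : ∀ {w} → ¬ Adj G u w → w ∈ vs
      ¬adj⇒∈ {w} u≁w = decidable-stable (w ∈? vs) (λ w∉vs → u≁w (∉⇒adj w∉vs))

    private
      ordered-edge? : ∀ u w → Dec (toℕ u < toℕ w × Adj G u w)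
      ordered-edge? u w = (toℕ u <? toℕ w) ×-dec adj? G u w

    𝟙-Adj-split : ∀ u w → 𝟙 (adj? G u w) ≡ 𝟙 (ordered-edge? u w) + 𝟙 (ordered-edge? w u)
    𝟙-Adj-split u w = case adj? G u w of λ where
      (no u≁w) → trans (𝟙-no (adj? G u w) u≁w)
        (sym (cong₂ _+_ (𝟙-no (ordered-edge? u w) (u≁w ∘ proj₂))
                        (𝟙-no (ordered-edge? w u) (u≁w ∘ Graph.sym G ∘ proj₂))))
      (yes u~w) → trans (𝟙-yes (adj? G u w) u~w) (case <-cmp (toℕ u) (toℕ w) of λ where
        (tri< u<w _ _) → sym (cong₂ _+_ (𝟙-yes (ordered-edge? u w) (u<w , u~w))
                                        (𝟙-no (ordered-edge? w u) (<-asym u<w ∘ proj₁)))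
        (tri≈ _ u≡w _) → contradiction (subst (Adj G u) (sym (toℕ-injective u≡w)) u~w) (irrefl G)
        (tri> _ _ w<u) → sym (cong₂ _+_ (𝟙-no (ordered-edge? u w) (<-asym w<u ∘ proj₁))
                                        (𝟙-yes (ordered-edge? w u) (w<u , Graph.sym G u~w))))

    edgeCount≡∑ : edgeCount G ≡ ∑[ u < n ] ∑[ w < n ] 𝟙 (ordered-edge? u w)
    edgeCount≡∑ =
      trans (count-cartesianProduct (λ p → ordered-edge? (proj₁ p) (proj₂ p)) id (allFin n))
            (sum-cong-≗ (λ u → count-tabulate (ordered-edge? u) id))

    handshake : ∑[ u < n ] degree G u ≡ 2 * edgeCount G
    handshake = begin
      ∑[ u < n ] degree G u
        ≡⟨ sum-cong-≗ (λ u → count-tabulate (adj? G u) id) ⟩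
      ∑[ u < n ] ∑[ w < n ] 𝟙 (adj? G u w)
        ≡⟨ sum-cong-≗ (λ u → sum-cong-≗ (𝟙-Adj-split u)) ⟩
      ∑[ u < n ] ∑[ w < n ] (e u w + e w u)
        ≡⟨ sum-cong-≗ (λ u → ∑-distrib-+ (e u) (λ w → e w u)) ⟩
      ∑[ u < n ] (∑[ w < n ] e u w + ∑[ w < n ] e w u)
        ≡⟨ ∑-distrib-+ (λ u → ∑[ w < n ] e u w) (λ u → ∑[ w < n ] e w u) ⟩
      E + ∑[ u < n ] ∑[ w < n ] e w u
        ≡⟨ cong (E +_) (∑-comm (λ u w → e w u)) ⟩
      E + E
        ≡⟨ cong (E +_) (+-identityʳ E) ⟨
      2 * E
        ≡⟨ cong (2 *_) edgeCount≡∑ ⟨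
      2 * edgeCount G ∎
      where
      open ≡-Reasoning
      e : Fin n → Fin n → ℕ
      e u w = 𝟙 (ordered-edge? u w)
      E : ℕ
      E = ∑[ u < n ] ∑[ w < n ] e u w

module _ {n : ℕ} (H : Graph n) {X V : Pred (Fin n) 0ℓ} (X? : Decidable X) (V? : Decidable V)
         (V⇒∉X : ∀ {v} → V v → ¬ X v) (V-Adj⇒X : ∀ {v w} → V v → Adj H v w → X w) where

  private
    #X #V : List (Fin n) → ℕ
    #X = count X?
    #V = count V?

    X⇒∉V : ∀ {x} → X x → ¬ V x
    X⇒∉V Xx Vx = V⇒∉X Vx Xx

  mutual
    #V≤1+#X : ∀ {p} → IsWalk H p → #V p ≤ suc (#X p)
    #V≤1+#X []           = z≤n
    #V≤1+#X {u ∷ p} walk = case V? u of λ where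
      (no ¬Vu) → m≤n⇒m≤1+n (#V≤#X-∉V ¬Vu walk)
      (yes Vu) → begin
        #V (u ∷ p)       ≡⟨ count-accept V? p Vu ⟩
        suc (#V p)       ≤⟨ s≤s (#V≤#X-after-V Vu walk) ⟩
        suc (#X p)       ≡⟨ cong suc (count-reject X? p (V⇒∉X Vu)) ⟨
        suc (#X (u ∷ p)) ∎
     where open ≤-Reasoning

    #V≤#X-after-V : ∀ {u p} → V u → IsWalk H (u ∷ p) → #V p ≤ #X p
    #V≤#X-after-V _  ([-] _)          = z≤n
    #V≤#X-after-V Vu (step u~w walk) = #V≤#X-∉V (X⇒∉V (V-Adj⇒X Vu u~w)) walk

    #V≤#X-∉V : ∀ {u p} → ¬ V u → IsWalk H (u ∷ p) → #V (u ∷ p) ≤ #X (u ∷ p)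
    #V≤#X-∉V ¬Vu ([-] _) = ≤-trans (≤-reflexive (count-reject V? [] ¬Vu)) z≤n
    #V≤#X-∉V {u} {w ∷ p} ¬Vu (step u~w walk) = begin
      #V (u ∷ w ∷ p) ≡⟨ count-reject V? (w ∷ p) ¬Vu ⟩
      #V (w ∷ p)     ≤⟨ tail-bound (X? u) ⟩
      #X (u ∷ w ∷ p) ∎
      where
      open ≤-Reasoning
      tail-bound : Dec (X u) → #V (w ∷ p) ≤ #X (u ∷ w ∷ p)
      tail-bound (yes Xu) = ≤-trans (#V≤1+#X walk) (≤-reflexive (sym (count-accept X? (w ∷ p) Xu)))
      tail-bound (no ¬Xu) = ≤-trans (#V≤#X-∉V (λ Vw → ¬Xu (V-Adj⇒X Vw (Graph.sym H u~w))) walk)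
                                    (≤-reflexive (sym (count-reject X? (w ∷ p) ¬Xu)))

  mutual
    #V≤#X : ∀ {p y} → IsWalk H p → y ∈ p → ¬ X y → ¬ V y → #V p ≤ #X p
    #V≤#X walk (here refl) _ ¬Vy = #V≤#X-∉V ¬Vy walk
    #V≤#X {u ∷ p} walk (there y∈p) ¬Xy ¬Vy = case V? u of λ where
      (no ¬Vu) → #V≤#X-∉V ¬Vu walk
      (yes Vu) → #V≤#X-through-V Vu walk y∈p ¬Xy ¬Vy

    #V≤#X-through-V : ∀ {u p y} → V u → IsWalk H (u ∷ p) → y ∈ p → ¬ X y → ¬ V y →
                      #V (u ∷ p) ≤ #X (u ∷ p)
    #V≤#X-through-V Vu (step u~w _) (here refl) ¬Xy _ = contradiction (V-Adj⇒X Vu u~w) ¬Xy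
    #V≤#X-through-V {u} {w ∷ r} Vu (step u~w (step _ walk)) (there y∈r) ¬Xy ¬Vy = begin
      #V (u ∷ w ∷ r)   ≡⟨ count-accept V? (w ∷ r) Vu ⟩
      suc (#V (w ∷ r)) ≡⟨ cong suc (count-reject V? r (X⇒∉V Xw)) ⟩
      suc (#V r)       ≤⟨ s≤s (#V≤#X walk y∈r ¬Xy ¬Vy) ⟩
      suc (#X r)       ≡⟨ count-accept X? r Xw ⟨
      #X (w ∷ r)       ≡⟨ count-reject X? (w ∷ r) (V⇒∉X Vu) ⟨
      #X (u ∷ w ∷ r)   ∎
      where
      open ≤-Reasoning
      Xw : X w
      Xw = V-Adj⇒X Vu u~w

module _ {n : ℕ} where

  open import Data.List.Membership.DecPropositional (_≟_ {n}) using (_∈?_)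

  ¬Traceable-of-common-neighbourhood :
    (H : Graph n) {V X : List (Fin n)} → Unique V → length X < length V →
    (∀ {v} → v ∈ V → v ∉ X) → (∀ {v w} → v ∈ V → Adj H v w → w ∈ X) →
    ∃[ y ] (y ∉ X × y ∉ V) → ¬ Traceable H
  ¬Traceable-of-common-neighbourhood H {V} {X} V! |X|<|V| V⇒∉X V-Adj⇒X (y , y∉X , y∉V)
                                     (p , walk , p! , ∈p) =
    <⇒≱ |X|<|V| (begin
      length V          ≤⟨ length≤count-∈? _≟_ V! (λ {v} _ → ∈p v) ⟩
      count (_∈? V) p   ≤⟨ #V≤#X H (_∈? X) (_∈? V) V⇒∉X V-Adj⇒X walk (∈p y) y∉X y∉V ⟩
      count (_∈? X) p   ≤⟨ count-∈?≤length _≟_ p! X ⟩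
      length X          ∎)
    where open ≤-Reasoning

module CommonNeighbourhood
  {n : ℕ} (G : Graph n) (G-mnt : MaximalNontraceable G)
  (V X : List (Fin n)) (V! : Unique V) (X! : Unique X)
  (|X|<|V| : length X < length V) (|X|+|V|<n : length X + length V < n)
  (degree-V : ∀ {v} → v ∈ V → degree G v ≡ length X)
  (V~X : ∀ {v x} → v ∈ V → x ∈ X → Adj G v x)
  where

  open import Data.List.Membership.DecPropositional (_≟_ {n}) using (_∈?_)

  private
    k ℓ : ℕ
    k = length V
    ℓ = length X

  V-Adj⇒X : ∀ {v w} → v ∈ V → Adj G v w → w ∈ X
  V-Adj⇒X v∈V = ∈-of-degree≡length G (degree-V v∈V) X! (All.tabulate (V~X v∈V))

  V⇒∉X : ∀ {v} → v ∈ V → v ∉ X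
  V⇒∉X v∈V v∈X = irrefl G (V~X v∈V v∈X)

  outside-vertex : ∃[ y ] (y ∉ X × y ∉ V)
  outside-vertex with ∃∉-of-length< (X ++ V) (subst (_< n) (sym (length-++ X)) |X|+|V|<n)
  ... | y , y∉X++V = y , y∉X++V ∘ ∈-++⁺ˡ , y∉X++V ∘ ∈-++⁺ʳ X

  complete-outside-V : ∀ {u w} → u ∉ V → w ∉ V → ¬ u ≡ w → Adj G u w
  complete-outside-V {u} {w} u∉V w∉V u≢w = decidable-stable (adj? G u w) λ u≁w →
    ¬Traceable-of-common-neighbourhood (addEdge G u w u≢w) V! |X|<|V| V⇒∉X V-Adj⇒X′ outside-vertex
      (proj₂ G-mnt u w u≢w u≁w)
    where
    V-Adj⇒X′ : ∀ {v y} → v ∈ V → Adj (addEdge G u w u≢w) v y → y ∈ X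
    V-Adj⇒X′ v∈V (inj₁ v~y)               = V-Adj⇒X v∈V v~y
    V-Adj⇒X′ v∈V (inj₂ (inj₁ (refl , _))) = contradiction v∈V u∉V
    V-Adj⇒X′ v∈V (inj₂ (inj₂ (refl , _))) = contradiction v∈V w∉V

  degree-X : ∀ {x} → x ∈ X → degree G x + 1 ≡ n
  degree-X {x} x∈X = degree+length≡n G ([] ∷ []) ∉⇒adj adj⇒∉
    where
    ∉⇒adj : ∀ {w} → w ∉ x ∷ [] → Adj G x w
    ∉⇒adj {w} w∉[x] with w ∈? V
    ... | yes w∈V = Graph.sym G (V~X w∈V x∈X)
    ... | no  w∉V = complete-outside-V (λ x∈V → V⇒∉X x∈V x∈X) w∉V (w∉[x] ∘ here ∘ sym)
    adj⇒∉ : ∀ {w} → Adj G x w → w ∉ x ∷ []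
    adj⇒∉ x~x (here refl) = irrefl G x~x

  degree-outside : ∀ {u} → u ∉ X → u ∉ V → degree G u + suc (length V) ≡ n
  degree-outside {u} u∉X u∉V = degree+length≡n G (¬Any⇒All¬ V u∉V ∷ V!) ∉⇒adj adj⇒∉
    where
    ∉⇒adj : ∀ {w} → w ∉ u ∷ V → Adj G u w
    ∉⇒adj w∉u∷V = complete-outside-V u∉V (w∉u∷V ∘ there) (w∉u∷V ∘ here ∘ sym)
    adj⇒∉ : ∀ {w} → Adj G u w → w ∉ u ∷ V
    adj⇒∉ u~u (here refl)  = irrefl G u~u
    adj⇒∉ u~w (there w∈V) = u∉X (V-Adj⇒X w∈V (Graph.sym G u~w))

  -- The degrees are |X| on V, n - 1 on X and n - 1 - |V| elsewhere; in this form the identity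
  -- sums over all vertices using only the sizes of V and X.
  degree-identity : ∀ u → degree G u + suc k + n * 𝟙 (u ∈? V)
                        ≡ n + k * 𝟙 (u ∈? X) + (suc k + ℓ) * 𝟙 (u ∈? V)
  degree-identity u with u ∈? V | u ∈? X
  ... | yes u∈V | yes u∈X = contradiction u∈X (V⇒∉X u∈V)
  ... | yes u∈V | no _    = begin
    degree G u + suc k + n * 1     ≡⟨ cong (λ d → d + suc k + n * 1) (degree-V u∈V) ⟩
    ℓ + suc k + n * 1              ≡⟨ arith ℓ k n ⟩
    n + k * 0 + (suc k + ℓ) * 1    ∎
    where
    open ≡-Reasoning
    arith : ∀ ℓ k n → ℓ + suc k + n * 1 ≡ n + k * 0 + (suc k + ℓ) * 1
    arith = solve-∀
  ... | no _    | yes u∈X = begin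
    degree G u + suc k + n * 0                ≡⟨ arith (degree G u) k n ℓ ⟩
    degree G u + 1 + k * 1 + (suc k + ℓ) * 0  ≡⟨ cong (λ m → m + k * 1 + (suc k + ℓ) * 0) (degree-X u∈X) ⟩
    n + k * 1 + (suc k + ℓ) * 0               ∎
    where
    open ≡-Reasoning
    arith : ∀ d k n ℓ → d + suc k + n * 0 ≡ d + 1 + k * 1 + (suc k + ℓ) * 0
    arith = solve-∀
  ... | no u∉V  | no u∉X  = begin
    degree G u + suc k + n * 0
      ≡⟨ arith (degree G u + suc k) n k ℓ ⟩
    degree G u + suc k + k * 0 + (suc k + ℓ) * 0
      ≡⟨ cong (λ m → m + k * 0 + (suc k + ℓ) * 0) (degree-outside u∉X u∉V) ⟩
    n + k * 0 + (suc k + ℓ) * 0 ∎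
    where
    open ≡-Reasoning
    arith : ∀ m n k ℓ → m + n * 0 ≡ m + k * 0 + (suc k + ℓ) * 0
    arith = solve-∀

  ∑-degree : ∑[ u < n ] degree G u + suc (2 * k) * n ≡ n * n + k * (suc k + 2 * ℓ)
  ∑-degree = begin
    D + suc (2 * k) * n
      ≡⟨ arith₁ D k n ⟩
    D + n * suc k + n * k
      ≡⟨ cong₂ (λ a b → D + a + b) (∑-const n (suc k)) (∑-*𝟙-∈? n V!) ⟨
    D + ∑[ u < n ] suc k + ∑[ u < n ] (n * 𝟙 (u ∈? V))
      ≡⟨ ∑-distrib₃ (degree G) (λ _ → suc k) (λ u → n * 𝟙 (u ∈? V)) ⟨
    ∑[ u < n ] (degree G u + suc k + n * 𝟙 (u ∈? V))
      ≡⟨ sum-cong-≗ degree-identity ⟩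
    ∑[ u < n ] (n + k * 𝟙 (u ∈? X) + (suc k + ℓ) * 𝟙 (u ∈? V))
      ≡⟨ ∑-distrib₃ (λ _ → n) (λ u → k * 𝟙 (u ∈? X)) (λ u → (suc k + ℓ) * 𝟙 (u ∈? V)) ⟩
    ∑[ u < n ] n + ∑[ u < n ] (k * 𝟙 (u ∈? X)) + ∑[ u < n ] ((suc k + ℓ) * 𝟙 (u ∈? V))
      ≡⟨ cong₂ _+_ (cong₂ _+_ (∑-const n n) (∑-*𝟙-∈? k X!)) (∑-*𝟙-∈? (suc k + ℓ) V!) ⟩
    n * n + k * ℓ + (suc k + ℓ) * k
      ≡⟨ arith₂ n k ℓ ⟩
    n * n + k * (suc k + 2 * ℓ) ∎
    where
    open ≡-Reasoning
    D : ℕ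
    D = ∑[ u < n ] degree G u
    arith₁ : ∀ D k n → D + suc (2 * k) * n ≡ D + n * suc k + n * k
    arith₁ = solve-∀
    arith₂ : ∀ n k ℓ → n * n + k * ℓ + (suc k + ℓ) * k ≡ n * n + k * (suc k + 2 * ℓ)
    arith₂ = solve-∀

  edgeCount-formula : 2 * edgeCount G + suc (2 * k) * n ≡ n * n + k * (suc k + 2 * ℓ)
  edgeCount-formula = trans (cong (_+ suc (2 * k) * n) (sym (handshake G))) ∑-degree

lemma5 : (n : ℕ) → 6 ≤ n → (G : Graph n) → MaximalNontraceable G →
    (v₁ v₂ v₃ x₁ x₂ : Fin n) →
    ¬ v₁ ≡ v₂ → ¬ v₁ ≡ v₃ → ¬ v₂ ≡ v₃ → ¬ x₁ ≡ x₂ →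
    degree G v₁ ≡ 2 → degree G v₂ ≡ 2 → degree G v₃ ≡ 2 →
    Adj G v₁ x₁ → Adj G v₁ x₂ → Adj G v₂ x₁ → Adj G v₂ x₂ →
    Adj G v₃ x₁ → Adj G v₃ x₂ →
    ((u w : Fin n) → ¬ u ≡ v₁ → ¬ u ≡ v₂ → ¬ u ≡ v₃ →
      ¬ w ≡ v₁ → ¬ w ≡ v₂ → ¬ w ≡ v₃ → ¬ u ≡ w → Adj G u w)
    × (2 * edgeCount G + 7 * n ≡ n * n + 24)
lemma5 n 6≤n G G-mnt v₁ v₂ v₃ x₁ x₂ v₁≢v₂ v₁≢v₃ v₂≢v₃ x₁≢x₂ deg₁ deg₂ deg₃
       v₁~x₁ v₁~x₂ v₂~x₁ v₂~x₂ v₃~x₁ v₃~x₂ =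
  (λ u w u≢v₁ u≢v₂ u≢v₃ w≢v₁ w≢v₂ w≢v₃ →
     complete-outside-V (∉V u≢v₁ u≢v₂ u≢v₃) (∉V w≢v₁ w≢v₂ w≢v₃)) ,
  edgeCount-formula
  where
  V X : List (Fin n)
  V = v₁ ∷ v₂ ∷ v₃ ∷ []
  X = x₁ ∷ x₂ ∷ []

  degree-V : ∀ {v} → v ∈ V → degree G v ≡ 2
  degree-V (here refl)                 = deg₁
  degree-V (there (here refl))         = deg₂
  degree-V (there (there (here refl))) = deg₃

  V~X : ∀ {v x} → v ∈ V → x ∈ X → Adj G v x
  V~X (here refl)                 (here refl)         = v₁~x₁
  V~X (here refl)                 (there (here refl)) = v₁~x₂
  V~X (there (here refl))         (here refl)         = v₂~x₁
  V~X (there (here refl))         (there (here refl)) = v₂~x₂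
  V~X (there (there (here refl))) (here refl)         = v₃~x₁
  V~X (there (there (here refl))) (there (here refl)) = v₃~x₂

  V! : Unique V
  V! = (v₁≢v₂ ∷ v₁≢v₃ ∷ []) ∷ (v₂≢v₃ ∷ []) ∷ [] ∷ []

  X! : Unique X
  X! = (x₁≢x₂ ∷ []) ∷ [] ∷ []

  open CommonNeighbourhood G G-mnt V X V! X! ≤-refl 6≤n degree-V V~X

  ∉V : ∀ {u} → ¬ u ≡ v₁ → ¬ u ≡ v₂ → ¬ u ≡ v₃ → u ∉ V
  ∉V u≢v₁ _ _ (here u≡v₁)                 = u≢v₁ u≡v₁
  ∉V _ u≢v₂ _ (there (here u≡v₂))         = u≢v₂ u≡v₂
  ∉V _ _ u≢v₃ (there (there (here u≡v₃))) = u≢v₃ u≡v₃
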